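{- Let $T$ be a complete binary tree equipped with rotor pointers, and let $v$ be a descendant of a node $u$ of $T$. Then $\mathrm{frnk}^T(v)=\mathrm{frnk}^T(u)+\mathrm{frnk}^{T[u]}(v)\cdot 2^{\ell(u)}$, where $\ell(u)$ is the level of $u$ in $T$.
   Context: $T$ is a complete binary tree with root at level $0$; $\ell(w)$ denotes the level of node $w$. Each non-leaf node has a rotor pointer pointing to one of its two children. For a tree $S$ (either $T$ or a subtree $T[u]$ rooted at $u$, which inherits the pointers of $T$ and whose levels are measured from $u$), the global path $P^S$ is the root-to-leaf path in $S$ obtained by starting at the root of $S$ and following pointers, and $P^S_d$ is its node at level $d$ of $S$. The operation $\mathrm{flip}^S(d)$ toggles the pointers of all nodes $P^S_{d'}$ for $d'<d$. For a node $w$ at level $d$ of $S$, the flip-rank $\mathrm{frnk}^S(w)\ge 0$ is the smallest number of consecutive $\mathrm{flip}^S(d)$ operations after which $w$ lies on $P^S$. -}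

module Defs where

open import Data.Nat using (ℕ; zero; suc; _∸_; _<_)
open import Data.Bool using (Bool; true; false; not; if_then_else_)
open import Data.List using (List; []; _∷_; length)
open import Data.Product using (_×_)
open import Data.Unit using (⊤)
open import Data.Empty using (⊥)
open import Relation.Binary.PropositionalEquality using (_≡_)
open import Relation.Nullary using (¬_)

-- A complete binary tree of height h (leaves at level h) with a rotor
-- pointer at every internal node: false = points to left child,
-- true = points to right child.
data Tree : ℕ → Set where
  leaf : Tree zero
  node : ∀ {n} → Bool → Tree n → Tree n → Tree (suc n)

-- A node is addressed by its root-to-node path (false = left, true = right);
-- its level is the length of the address.
Node : Set
Node = List Bool

level : Node → ℕ
level = length

child : ∀ {n} → Bool → Tree n → Tree n → Tree n
child false l r = l
child true  l r = r

data IsNode : ∀ {h} → Tree h → Node → Set where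
  here  : ∀ {h} {t : Tree h} → IsNode t []
  there : ∀ {n} {b : Bool} {l r : Tree n} {x : Bool} {xs : Node} →
          IsNode (child x l r) xs → IsNode (node b l r) (x ∷ xs)

OnPath : ∀ {h} → Tree h → Node → Set
OnPath t []                   = ⊤
OnPath leaf (x ∷ xs)          = ⊥
OnPath (node b l r) (x ∷ xs)  = (x ≡ b) × OnPath (child b l r) xs

-- flip d : toggle the pointers of P_0, …, P_{d-1}
flip : ∀ {h} → ℕ → Tree h → Tree h
flip zero t                 = t
flip (suc d) leaf           = leaf
flip (suc d) (node false l r) = node true (flip d l) r
flip (suc d) (node true  l r) = node false l (flip d r)

flips : ∀ {h} → ℕ → ℕ → Tree h → Tree h
flips d zero    t = t
flips d (suc k) t = flips d k (flip d t)

IsFrnk : ∀ {h} → Tree h → Node → ℕ → Set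
IsFrnk t w k = OnPath (flips (level w) k t) w
             × (∀ j → j < k → ¬ OnPath (flips (level w) j t) w)

subtree : ∀ {h} → Tree h → (u : Node) → Tree (h ∸ length u)
subtree t [] = t
subtree leaf (x ∷ xs) = leaf
subtree (node b l r) (x ∷ xs) = subtree (child x l r) xs

module Submission where

-- Two consecutive flips at level d + 1 restore the root pointer and flip both
-- subtrees at level d once.  Hence after e + 2m flips (e ∈ {0,1}) the root
-- points to b xor e and the subtree it points to has received m flips, so the
-- flip-rank of x ∷ w is [x ≠ b] + 2 · (flip-rank of w in the subtree at x):
-- it is the binary number whose digits, least significant first, record where
-- the address of the node leaves the global path.  Concatenating addresses
-- concatenates these digit strings, which is the claimed formula.

open import Defs
open import Data.Nat using (ℕ; zero; suc; _+_; _*_; _^_; _<_)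
open import Data.Nat.Properties using (*-suc; *-identityʳ; <-cmp; +-cancelˡ-<; *-cancelˡ-<)
open import Data.Nat.Tactic.RingSolver using (solve-∀)
open import Data.Bool using (Bool; true; false; _xor_)
open import Data.Bool.Properties using (not-involutive)
open import Data.List using ([]; _∷_; length; _++_)
open import Data.Product using (_×_; _,_; ∃₂)
open import Data.Unit using (tt)
open import Data.Empty using (⊥; ⊥-elim)
open import Function using (id)
open import Relation.Binary using (tri<; tri≈; tri>)
open import Relation.Binary.PropositionalEquality
  using (_≡_; refl; sym; cong; cong₂; subst; module ≡-Reasoning)

bit : Bool → ℕ
bit false = 0
bit true  = 1

parity : ∀ j → ∃₂ λ e m → j ≡ bit e + 2 * m
parity zero = false , 0 , refl
parity (suc j) with parity j
... | false , m , refl = true , m , refl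
... | true  , m , refl = false , suc m , sym (*-suc 2 m)

xor-cancelˡ : ∀ b c → b xor (b xor c) ≡ c
xor-cancelˡ false c = refl
xor-cancelˡ true  c = not-involutive c

flip-twice : ∀ {n} d b (l r : Tree n) →
             flips (suc d) 2 (node b l r) ≡ node b (flip d l) (flip d r)
flip-twice d false l r = refl
flip-twice d true  l r = refl

flips-even : ∀ {n} d m b (l r : Tree n) →
             flips (suc d) (2 * m) (node b l r) ≡ node b (flips d m l) (flips d m r)
flips-even d zero    b l r = refl
flips-even d (suc m) b l r = begin
  flips (suc d) (2 * suc m) (node b l r)
    ≡⟨ cong (λ k → flips (suc d) k (node b l r)) (*-suc 2 m) ⟩
  flips (suc d) (2 * m) (flips (suc d) 2 (node b l r))
    ≡⟨ cong (flips (suc d) (2 * m)) (flip-twice d b l r) ⟩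
  flips (suc d) (2 * m) (node b (flip d l) (flip d r))
    ≡⟨ flips-even d m b (flip d l) (flip d r) ⟩
  node b (flips d (suc m) l) (flips d (suc m) r) ∎
  where open ≡-Reasoning

OnPath-flips-node : ∀ {n} (ws : Node) e m b x (l r : Tree n) →
  OnPath (flips (level (x ∷ ws)) (bit e + 2 * m) (node b l r)) (x ∷ ws)
    ≡ ((x ≡ b xor e) × OnPath (flips (level ws) m (child (b xor e) l r)) ws)
OnPath-flips-node ws false m false x l r rewrite flips-even (length ws) m false l r = refl
OnPath-flips-node ws false m true  x l r rewrite flips-even (length ws) m true l r = refl
OnPath-flips-node ws true  m false x l r rewrite flips-even (length ws) m true (flip (length ws) l) r = refl
OnPath-flips-node ws true  m true  x l r rewrite flips-even (length ws) m false l (flip (length ws) r) = refl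

IsFrnk-∷ : ∀ {n} b (l r : Tree n) x ws f → IsFrnk (child x l r) ws f →
           IsFrnk (node b l r) (x ∷ ws) (bit (b xor x) + 2 * f)
IsFrnk-∷ b l r x ws f (onPath , minimal) = reached , earlier-missed
  where
  reached : OnPath (flips (level (x ∷ ws)) (bit (b xor x) + 2 * f) (node b l r)) (x ∷ ws)
  reached rewrite OnPath-flips-node ws (b xor x) f b x l r | xor-cancelˡ b x = refl , onPath

  earlier-missed : ∀ j → j < bit (b xor x) + 2 * f →
                   OnPath (flips (level (x ∷ ws)) j (node b l r)) (x ∷ ws) → ⊥
  earlier-missed j j<k q with parity j
  ... | e , m , refl with subst id (OnPath-flips-node ws e m b x l r) q
  ...   | refl , q′ rewrite xor-cancelˡ b e =
    minimal m (*-cancelˡ-< 2 m f (+-cancelˡ-< (bit e) (2 * m) (2 * f) j<k)) q′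

frnk : ∀ {h} → Tree h → Node → ℕ
-- The leaf clause is junk: addresses that run past a leaf are not nodes.
frnk t            []       = 0
frnk leaf         (x ∷ xs) = 0
frnk (node b l r) (x ∷ xs) = bit (b xor x) + 2 * frnk (child x l r) xs

IsFrnk-frnk : ∀ {h} {t : Tree h} {w} → IsNode t w → IsFrnk t w (frnk t w)
IsFrnk-frnk here = tt , λ j ()
IsFrnk-frnk {t = node b l r} {x ∷ xs} (there p) = IsFrnk-∷ b l r x xs _ (IsFrnk-frnk p)

IsFrnk-unique : ∀ {h} {t : Tree h} {w k k′} → IsFrnk t w k → IsFrnk t w k′ → k ≡ k′
IsFrnk-unique {k = k} {k′} (p , minimal) (p′ , minimal′) with <-cmp k k′
... | tri< k<k′ _ _ = ⊥-elim (minimal′ k k<k′ p)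
... | tri≈ _ k≡k′ _ = k≡k′
... | tri> _ _ k′<k = ⊥-elim (minimal k′ k′<k p′)

frnk-leaf : ∀ s → frnk leaf s ≡ 0
frnk-leaf []      = refl
frnk-leaf (x ∷ s) = refl

frnk-++ : ∀ {h} (t : Tree h) u s →
          frnk t (u ++ s) ≡ frnk t u + frnk (subtree t u) s * 2 ^ level u
frnk-++ t            []      s = sym (*-identityʳ (frnk t s))
frnk-++ leaf         (x ∷ u) s = cong (_* 2 ^ level (x ∷ u)) (sym (frnk-leaf s))
frnk-++ (node b l r) (x ∷ u) s
  rewrite frnk-++ (child x l r) u s =
    digits-shift (bit (b xor x)) (frnk (child x l r) u)
                 (frnk (subtree (child x l r) u) s) (2 ^ level u)
  where
  digits-shift : ∀ e a c q → e + 2 * (a + c * q) ≡ (e + 2 * a) + c * (2 * q)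
  digits-shift = solve-∀

IsNode-prefix : ∀ {h} {t : Tree h} u {s} → IsNode t (u ++ s) → IsNode t u
IsNode-prefix []      p         = here
IsNode-prefix (x ∷ u) (there p) = there (IsNode-prefix u p)

IsNode-subtree : ∀ {h} {t : Tree h} u {s} → IsNode t (u ++ s) → IsNode (subtree t u) s
IsNode-subtree []      p         = p
IsNode-subtree (x ∷ u) (there p) = IsNode-subtree u p

lemma2 : ∀ {h} (t : Tree h) (u s : Node) → IsNode t (u ++ s) →
         ∀ (ku ks : ℕ) → IsFrnk t u ku → IsFrnk (subtree t u) s ks →
         IsFrnk t (u ++ s) (ku + ks * 2 ^ level u)
lemma2 t u s p ku ks u-rank s-rank = subst (IsFrnk t (u ++ s)) frnk≡ (IsFrnk-frnk p)
  where
  open ≡-Reasoning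
  frnk≡ : frnk t (u ++ s) ≡ ku + ks * 2 ^ level u
  frnk≡ = begin
    frnk t (u ++ s)                                   ≡⟨ frnk-++ t u s ⟩
    frnk t u + frnk (subtree t u) s * 2 ^ level u
      ≡⟨ cong₂ (λ a c → a + c * 2 ^ level u)
               (IsFrnk-unique (IsFrnk-frnk (IsNode-prefix u p)) u-rank)
               (IsFrnk-unique (IsFrnk-frnk (IsNode-subtree u p)) s-rank) ⟩
    ku + ks * 2 ^ level u                             ∎
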